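{- Let $q\in\{2,3,4\}$ and $11\le d\le 50$, and let $n_q(d)$ be the value given in the context. Then for every even integer $n\ge n_q(d)$ there is a double Toeplitz $[n,n/2]$ code over $\mathbb{F}_q$ with minimum weight at least $d$.
   Context: For $m\ge1$, $t\in\mathbb{F}_q$, $a=(a_1,\dots,a_{m-1})$, $b=(b_1,\dots,b_{m-1})\in\mathbb{F}_q^{m-1}$, the Toeplitz matrix $T(t,a,b)$ is the $m\times m$ matrix whose $(i,j)$ entry is $t$ if $i=j$, $a_{j-i}$ if $j>i$, and $b_{i-j}$ if $i>j$. A double Toeplitz $[n,n/2]$ code over $\mathbb{F}_q$ is the linear code with generator matrix $(I_{n/2}\mid T(t,a,b))$ for some such $t,a,b$ with $m=n/2$. Minimum weight is the smallest Hamming weight of a nonzero codeword. The values $n_q(d)$, listed for $d=11,12,\dots,50$ in order, are: $n_2(d)$: 84, 92, 102, 110, 120, 128, 138, 146, 156, 164, 172, 182, 190, 200, 208, 218, 226, 236, 244, 254, 264, 272, 282, 290, 300, 308, 318, 326, 336, 344, 354, 362, 372, 380, 390, 398, 408, 416, 426, 434; $n_3(d)$: 56, 62, 68, 76, 82, 88, 94, 100, 106, 112, 118, 124, 130, 138, 144, 150, 156, 162, 168, 174, 180, 186, 194, 200, 206, 212, 218, 224, 230, 236, 244, 250, 256, 262, 268, 274, 280, 286, 294, 300; $n_4(d)$: 48, 52, 58, 64, 68, 74, 78, 84, 90, 94, 100, 104, 110, 116, 120, 126, 132, 136, 142, 146, 152, 158, 162, 168, 174, 178, 184, 188, 194, 200,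 204, 210, 216, 220, 226, 230, 236, 242, 246, 252. -}

module Defs where

open import Data.Nat using (ℕ; zero; suc; _+_; _∸_; _<ᵇ_)
open import Data.Bool using (Bool; true; false; if_then_else_)
open import Data.Fin using (Fin; toℕ) renaming (zero to fz; suc to fs)
import Data.Fin as Fin
open import Data.List using (List; []; _∷_; foldr; map; allFin; length; filter)
open import Relation.Nullary using (¬_; Dec; yes; no)
open import Relation.Nullary.Decidable using (⌊_⌋; ¬?)
open import Relation.Binary.PropositionalEquality using (_≡_)
open import Data.Product using (∃)

data FieldSize : Set where
  GF2 GF3 GF4 : FieldSize

order : FieldSize → ℕ
order GF2 = 2
order GF3 = 3
order GF4 = 4

-- Elements of F_q are encoded as Fin q.
-- F_2, F_3 : residues mod 2, mod 3.
-- F_4 = F_2[ω]/(ω²+ω+1) : 0 ↦ 0, 1 ↦ 1, 2 ↦ ω, 3 ↦ ω+1 = ω².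
F : FieldSize → Set
F q = Fin (order q)

𝟘 : (q : FieldSize) → F q
𝟘 GF2 = fz
𝟘 GF3 = fz
𝟘 GF4 = fz

private
  f0 f1 f2 f3 : {n : ℕ} → Fin (4 + n)
  f0 = fz
  f1 = fs fz
  f2 = fs (fs fz)
  f3 = fs (fs (fs fz))

add : (q : FieldSize) → F q → F q → F q
add GF2 fz y = y
add GF2 (fs fz) fz = fs fz
add GF2 (fs fz) (fs fz) = fz
add GF3 fz y = y
add GF3 x fz = x
add GF3 (fs fz) (fs fz) = fs (fs fz)
add GF3 (fs fz) (fs (fs fz)) = fz
add GF3 (fs (fs fz)) (fs fz) = fz
add GF3 (fs (fs fz)) (fs (fs fz)) = fs fz
-- F_4 (characteristic 2: bitwise xor of the encodings)
add GF4 fz y = y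
add GF4 x fz = x
add GF4 (fs fz) (fs fz) = fz
add GF4 (fs fz) (fs (fs fz)) = fs (fs (fs fz))
add GF4 (fs fz) (fs (fs (fs fz))) = fs (fs fz)
add GF4 (fs (fs fz)) (fs fz) = fs (fs (fs fz))
add GF4 (fs (fs fz)) (fs (fs fz)) = fz
add GF4 (fs (fs fz)) (fs (fs (fs fz))) = fs fz
add GF4 (fs (fs (fs fz))) (fs fz) = fs (fs fz)
add GF4 (fs (fs (fs fz))) (fs (fs fz)) = fs fz
add GF4 (fs (fs (fs fz))) (fs (fs (fs fz))) = fz

mul : (q : FieldSize) → F q → F q → F q
mul GF2 fz y = fz
mul GF2 (fs fz) y = y
mul GF3 fz y = fz
mul GF3 (fs fz) y = y
mul GF3 (fs (fs fz)) fz = fz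
mul GF3 (fs (fs fz)) (fs fz) = fs (fs fz)
mul GF3 (fs (fs fz)) (fs (fs fz)) = fs fz
-- F_4 : ω·ω = ω+1, ω·(ω+1) = 1, (ω+1)·(ω+1) = ω
mul GF4 fz y = fz
mul GF4 (fs fz) y = y
mul GF4 (fs (fs fz)) fz = fz
mul GF4 (fs (fs fz)) (fs fz) = fs (fs fz)
mul GF4 (fs (fs fz)) (fs (fs fz)) = fs (fs (fs fz))
mul GF4 (fs (fs fz)) (fs (fs (fs fz))) = fs fz
mul GF4 (fs (fs (fs fz))) fz = fz
mul GF4 (fs (fs (fs fz))) (fs fz) = fs (fs (fs fz))
mul GF4 (fs (fs (fs fz))) (fs (fs fz)) = fs fz
mul GF4 (fs (fs (fs fz))) (fs (fs (fs fz))) = fs (fs fz)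

-- Vectors over F_q of length k are functions Fin k → F q.
-- at v s = v_s for 1 ≤ s ≤ k (1-based indexing as in the paper);
-- the value outside that range is never used.
at : {q : FieldSize} {k : ℕ} → (Fin k → F q) → ℕ → F q
at {q} {zero} v s = 𝟘 q
at {q} {suc k} v zero = 𝟘 q
at {q} {suc k} v (suc zero) = v fz
at {q} {suc k} v (suc (suc s)) = at {q} {k} (λ i → v (fs i)) (suc s)

toeplitz : (q : FieldSize) (m : ℕ) → F q → (Fin (m ∸ 1) → F q) → (Fin (m ∸ 1) → F q)
         → Fin m → Fin m → F q
toeplitz q m t a b i j =
  if toℕ i <ᵇ toℕ j then at a (toℕ j ∸ toℕ i)
  else if toℕ j <ᵇ toℕ i then at b (toℕ i ∸ toℕ j)
  else t

sumF : (q : FieldSize) → List (F q) → F q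
sumF q = foldr (add q) (𝟘 q)

-- Codeword x·(I_m | T) = (x , x·T) for a message x ∈ F_q^m.
-- Right half: (x·T)_j = Σ_i x_i T_{ij}.
rightHalf : (q : FieldSize) (m : ℕ) → (Fin m → Fin m → F q) → (Fin m → F q) → Fin m → F q
rightHalf q m T x j = sumF q (map (λ i → mul q (x i) (T i j)) (allFin m))

wt : (q : FieldSize) (k : ℕ) → (Fin k → F q) → ℕ
wt q k v = length (filter (λ i → ¬? (v i Fin.≟ 𝟘 q)) (allFin k))


codewordWeight : (q : FieldSize) (m : ℕ) → (Fin m → Fin m → F q) → (Fin m → F q) → ℕ
codewordWeight q m T x = wt q m x + wt q m (rightHalf q m T x)

-- Since (I_m | T) has full rank,
-- the nonzero codewords are exactly x·(I_m | T) with x ≠ 0.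
MinWeightAtLeast : (q : FieldSize) (m : ℕ) → (Fin m → Fin m → F q) → ℕ → Set
MinWeightAtLeast q m T d =
  (x : Fin m → F q) → ∃ (λ i → ¬ (x i ≡ 𝟘 q)) → d Data.Nat.≤ codewordWeight q m T x

table : FieldSize → List ℕ
table GF2 = 84 ∷ 92 ∷ 102 ∷ 110 ∷ 120 ∷ 128 ∷ 138 ∷ 146 ∷ 156 ∷ 164 ∷ 172 ∷ 182 ∷ 190 ∷ 200 ∷ 208 ∷ 218 ∷ 226 ∷ 236 ∷ 244 ∷ 254 ∷ 264 ∷ 272 ∷ 282 ∷ 290 ∷ 300 ∷ 308 ∷ 318 ∷ 326 ∷ 336 ∷ 344 ∷ 354 ∷ 362 ∷ 372 ∷ 380 ∷ 390 ∷ 398 ∷ 408 ∷ 416 ∷ 426 ∷ 434 ∷ []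
table GF3 = 56 ∷ 62 ∷ 68 ∷ 76 ∷ 82 ∷ 88 ∷ 94 ∷ 100 ∷ 106 ∷ 112 ∷ 118 ∷ 124 ∷ 130 ∷ 138 ∷ 144 ∷ 150 ∷ 156 ∷ 162 ∷ 168 ∷ 174 ∷ 180 ∷ 186 ∷ 194 ∷ 200 ∷ 206 ∷ 212 ∷ 218 ∷ 224 ∷ 230 ∷ 236 ∷ 244 ∷ 250 ∷ 256 ∷ 262 ∷ 268 ∷ 274 ∷ 280 ∷ 286 ∷ 294 ∷ 300 ∷ []
table GF4 = 48 ∷ 52 ∷ 58 ∷ 64 ∷ 68 ∷ 74 ∷ 78 ∷ 84 ∷ 90 ∷ 94 ∷ 100 ∷ 104 ∷ 110 ∷ 116 ∷ 120 ∷ 126 ∷ 132 ∷ 136 ∷ 142 ∷ 146 ∷ 152 ∷ 158 ∷ 162 ∷ 168 ∷ 174 ∷ 178 ∷ 184 ∷ 188 ∷ 194 ∷ 200 ∷ 204 ∷ 210 ∷ 216 ∷ 220 ∷ 226 ∷ 230 ∷ 236 ∷ 242 ∷ 246 ∷ 252 ∷ []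

nth : List ℕ → ℕ → ℕ
nth [] _ = 0
nth (x ∷ xs) zero = x
nth (x ∷ xs) (suc k) = nth xs k

nq : FieldSize → ℕ → ℕ
nq q d = nth (table q) (d ∸ 11)

-- Parametrise T(t,a,b) by its 2m − 1 diagonals c and fix a message x whose first nonzero
-- entry is 1.  The map c ↦ (x·T_c, the m − 1 diagonals missed by the row of that entry) is
-- injective, so every right half y arises from at most q^(m−1) matrices.  Summing over x and y,
-- at most N·q^(m−1) of the q^(2m−1) matrices have a codeword of weight < d, where N counts the
-- normalised words of length 2m and weight < d.  As (q − 1)·N + 1 is the volume V of the Hamming
-- ball of radius d − 1, a good matrix exists once V ≤ (q − 1)·q^m.  For each table entry this is
-- checked by evaluation at m = ⌊n_q(d)/2⌋; it persists for larger m because C(n+2, w) ≤ q·C(n, w)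
-- for all w < d as soon as (n+2)(n+1) ≤ q(n−w+1)(n−w+2), a condition that improves as n grows.

module Submission where

open import Defs
open import Data.Nat using (ℕ; _≤_; _*_; _∸_)
open import Data.Fin using (Fin)
open import Data.Product using (∃; ∃-syntax)

open import Data.Nat using (zero; suc; _+_; _<_; _^_; z≤n; s≤s; z<s; _<ᵇ_; NonZero; ⌊_/2⌋)
open import Data.Nat.Properties hiding (_≟_)
open import Data.Nat.Combinatorics using (_C_; nCk+nC[k+1]≡[n+1]C[k+1]; nC1≡n)
open import Data.Nat.Induction using (<-rec)
open import Data.Nat.ListAction using (sum)
open import Data.Nat.ListAction.Properties using (sum-++)
open import Data.Nat.Tactic.RingSolver using (solve-∀)
open import Algebra.Properties.CommutativeSemigroup +-commutativeSemigroup using () renaming (interchange to +-interchange)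
open import Algebra.Properties.CommutativeSemigroup *-commutativeSemigroup using (x∙yz≈y∙xz)
open import Data.Fin using (toℕ; fromℕ<; _≟_) renaming (zero to fz; suc to fs)
import Data.Fin as Fin
open import Data.Fin.Properties using (all?; any?; toℕ-fromℕ<; toℕ-injective; toℕ≤pred[n]) renaming (suc-injective to fs-injective)
open import Data.List using (List; []; _∷_; _++_; [_]; map; length; filter; allFin; cartesianProductWith; cartesianProduct)
import Data.List as List
open import Data.List.Properties using (map-cong; map-tabulate; map-++; map-∘; length-++; length-map; length-tabulate)
open import Data.List.Membership.Propositional using (_∈_; lose)
open import Data.List.Membership.Propositional.Properties
  using (∈-∃++; ∈-++⁻; ∈-++⁺ˡ; ∈-++⁺ʳ; ∈-allFin; ∈-cartesianProductWith⁺; ∈-cartesianProduct⁺; ∈-filter⁺; ∈-filter⁻; ∈-map⁻)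
open import Data.List.Relation.Unary.Any using (Any; here; there)
import Data.List.Relation.Unary.Any as Any
open import Data.List.Relation.Unary.All using ([]; _∷_)
import Data.List.Relation.Unary.All as All
open import Data.List.Relation.Unary.AllPairs using ([]; _∷_)
open import Data.List.Relation.Unary.Unique.Propositional using (Unique)
import Data.List.Relation.Unary.Unique.Propositional.Properties as Unique
open import Data.Vec using (Vec; []; _∷_; lookup; tabulate)
import Data.Vec as Vec
open import Data.Vec.Properties using (∷-injective; lookup∘tabulate; tabulate∘lookup; tabulate-cong; tabulate-∘; lookup-map)
open import Data.Product using (_×_; _,_; proj₁; proj₂)
open import Data.Sum using (inj₁; inj₂)
open import Data.Bool using (true; false; if_then_else_)
open import Function using (_∘_; id)
open import Relation.Nullary using (Dec; yes; no; ¬_; ¬?; does; contradiction)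
open import Relation.Nullary.Reflects using (ofʸ; ofⁿ)
open import Relation.Nullary.Decidable using (True; toWitness; map′; _→-dec_; _×-dec_)
open import Relation.Unary using (Decidable)
open import Relation.Binary.Definitions using (tri<; tri≈; tri>)
open import Relation.Binary.PropositionalEquality using (_≡_; _≢_; refl; sym; trans; cong; cong₂; subst; module ≡-Reasoning)

private
  variable
    A B : Set

one : (q : FieldSize) → F q
one GF2 = fs fz
one GF3 = fs fz
one GF4 = fs fz

byEnumeration : {P : FieldSize → Set} (P? : ∀ q → Dec (P q))
  → {p₂ : True (P? GF2)} {p₃ : True (P? GF3)} {p₄ : True (P? GF4)} → ∀ q → P q
byEnumeration P? {p₂} GF2 = toWitness p₂
byEnumeration P? {p₃ = p₃} GF3 = toWitness p₃
byEnumeration P? {p₄ = p₄} GF4 = toWitness p₄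

mul-zeroˡ : (q : FieldSize) (a : F q) → mul q (𝟘 q) a ≡ 𝟘 q
mul-zeroˡ = byEnumeration λ q → all? λ a → mul q (𝟘 q) a ≟ 𝟘 q

mul-zeroʳ : (q : FieldSize) (a : F q) → mul q a (𝟘 q) ≡ 𝟘 q
mul-zeroʳ = byEnumeration λ q → all? λ a → mul q a (𝟘 q) ≟ 𝟘 q

mul-assoc : (q : FieldSize) (a b c : F q) → mul q (mul q a b) c ≡ mul q a (mul q b c)
mul-assoc = byEnumeration λ q → all? λ a → all? λ b → all? λ c →
  mul q (mul q a b) c ≟ mul q a (mul q b c)

mul-distribˡ-add : (q : FieldSize) (a b c : F q) → mul q a (add q b c) ≡ add q (mul q a b) (mul q a c)
mul-distribˡ-add = byEnumeration λ q → all? λ a → all? λ b → all? λ c →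
  mul q a (add q b c) ≟ add q (mul q a b) (mul q a c)

add-cancelˡ : (q : FieldSize) (a b c : F q) → add q a b ≡ add q a c → b ≡ c
add-cancelˡ = byEnumeration λ q → all? λ a → all? λ b → all? λ c →
  add q a b ≟ add q a c →-dec b ≟ c

add-cancelʳ : (q : FieldSize) (a b c : F q) → add q b a ≡ add q c a → b ≡ c
add-cancelʳ = byEnumeration λ q → all? λ a → all? λ b → all? λ c →
  add q b a ≟ add q c a →-dec b ≟ c

mul-cancelˡ : (q : FieldSize) (a b c : F q) → a ≢ 𝟘 q → mul q a b ≡ mul q a c → b ≡ c
mul-cancelˡ = byEnumeration λ q → all? λ a → all? λ b → all? λ c →
  ¬? (a ≟ 𝟘 q) →-dec (mul q a b ≟ mul q a c →-dec b ≟ c)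

mul-inverseˡ : (q : FieldSize) (a : F q) → a ≢ 𝟘 q → ∃ λ b → b ≢ 𝟘 q × mul q b a ≡ one q
mul-inverseˡ = byEnumeration λ q → all? λ a → ¬? (a ≟ 𝟘 q) →-dec any? λ b →
  ¬? (b ≟ 𝟘 q) ×-dec mul q b a ≟ one q

one≢𝟘 : (q : FieldSize) → one q ≢ 𝟘 q
one≢𝟘 = byEnumeration λ q → ¬? (one q ≟ 𝟘 q)

sumFin : (q : FieldSize) {n : ℕ} → (Fin n → F q) → F q
sumFin q {n} f = sumF q (map f (allFin n))

module _ (q : FieldSize) where

  sumFin-suc : ∀ {n} (f : Fin (suc n) → F q) → sumFin q f ≡ add q (f fz) (sumFin q (f ∘ fs))
  sumFin-suc {n} f = cong (add q (f fz) ∘ sumF q)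
    (trans (map-tabulate fs f) (sym (map-tabulate id (f ∘ fs))))

  sumFin-cong : ∀ {n} {f g : Fin n → F q} → (∀ i → f i ≡ g i) → sumFin q f ≡ sumFin q g
  sumFin-cong {n} f≗g = cong (sumF q) (map-cong f≗g (allFin n))

  sumFin-scale : ∀ {n} (μ : F q) (f : Fin n → F q) → sumFin q (λ i → mul q μ (f i)) ≡ mul q μ (sumFin q f)
  sumFin-scale {zero} μ f = sym (mul-zeroʳ q μ)
  sumFin-scale {suc n} μ f = begin
    sumFin q (λ i → mul q μ (f i))                      ≡⟨ sumFin-suc (λ i → mul q μ (f i)) ⟩
    add q (mul q μ (f fz)) (sumFin q (λ i → mul q μ (f (fs i)))) ≡⟨ cong (add q _) (sumFin-scale μ (f ∘ fs)) ⟩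
    add q (mul q μ (f fz)) (mul q μ (sumFin q (f ∘ fs)))  ≡⟨ mul-distribˡ-add q μ _ _ ⟨
    mul q μ (add q (f fz) (sumFin q (f ∘ fs)))            ≡⟨ cong (mul q μ) (sumFin-suc f) ⟨
    mul q μ (sumFin q f)                                  ∎
    where open ≡-Reasoning

  sumFin-suc-≡ : ∀ {n} {f g : Fin (suc n) → F q} → sumFin q f ≡ sumFin q g →
    add q (f fz) (sumFin q (f ∘ fs)) ≡ add q (g fz) (sumFin q (g ∘ fs))
  sumFin-suc-≡ {f = f} {g} f≡g = trans (sym (sumFin-suc f)) (trans f≡g (sumFin-suc g))

  sumFin-cancel : ∀ {n} {f g : Fin n → F q} (k : Fin n) → (∀ i → i ≢ k → f i ≡ g i)
    → sumFin q f ≡ sumFin q g → f k ≡ g k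
  sumFin-cancel {f = f} {g} fz others f≡g = add-cancelʳ q _ _ _
    (trans (sumFin-suc-≡ {f = f} {g} f≡g) (cong (add q (g fz)) (sumFin-cong λ i → sym (others (fs i) λ ()))))
  sumFin-cancel {f = f} {g} (fs k) others f≡g = sumFin-cancel k (λ i i≢k → others (fs i) (i≢k ∘ fs-injective))
    (add-cancelˡ q (f fz) _ _ (trans (sumFin-suc-≡ {f = f} {g} f≡g) (cong (λ a → add q a _) (sym (others fz λ ())))))

∑ : List A → (A → ℕ) → ℕ
∑ xs f = sum (map f xs)

syntax ∑ xs (λ x → e) = ∑[ x ∈ xs ] e

∑-cong : ∀ (xs : List A) {f g : A → ℕ} → (∀ x → f x ≡ g x) → ∑ xs f ≡ ∑ xs g
∑-cong xs f≗g = cong sum (map-cong f≗g xs)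

∑-mono-≤ : ∀ (xs : List A) {f g : A → ℕ} → (∀ x → f x ≤ g x) → ∑ xs f ≤ ∑ xs g
∑-mono-≤ []       f≤g = z≤n
∑-mono-≤ (x ∷ xs) f≤g = +-mono-≤ (f≤g x) (∑-mono-≤ xs f≤g)

∑-++ : ∀ (xs ys : List A) (f : A → ℕ) → ∑ (xs ++ ys) f ≡ ∑ xs f + ∑ ys f
∑-++ xs ys f = trans (cong sum (map-++ f xs ys)) (sum-++ (map f xs) (map f ys))

∑-distrib-+ : ∀ (xs : List A) (f g : A → ℕ) → ∑[ x ∈ xs ] (f x + g x) ≡ ∑ xs f + ∑ xs g
∑-distrib-+ []       f g = refl
∑-distrib-+ (x ∷ xs) f g = trans (cong (f x + g x +_) (∑-distrib-+ xs f g))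
                                 (+-interchange (f x) (g x) (∑ xs f) (∑ xs g))

∑-*ʳ : ∀ (xs : List A) (f : A → ℕ) (k : ℕ) → ∑[ x ∈ xs ] (f x * k) ≡ ∑ xs f * k
∑-*ʳ []       f k = refl
∑-*ʳ (x ∷ xs) f k = trans (cong (f x * k +_) (∑-*ʳ xs f k)) (sym (*-distribʳ-+ k (f x) (∑ xs f)))

∑-const : ∀ (xs : List A) (k : ℕ) → ∑[ _ ∈ xs ] k ≡ length xs * k
∑-const []       k = refl
∑-const (x ∷ xs) k = cong (k +_) (∑-const xs k)

∑-comm : ∀ (xs : List A) (ys : List B) (h : A → B → ℕ) →
  ∑[ x ∈ xs ] ∑[ y ∈ ys ] h x y ≡ ∑[ y ∈ ys ] ∑[ x ∈ xs ] h x y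
∑-comm []       ys h = sym (trans (∑-const ys 0) (*-zeroʳ (length ys)))
∑-comm (x ∷ xs) ys h = trans (cong (∑ ys (h x) +_) (∑-comm xs ys h))
                             (sym (∑-distrib-+ ys (h x) _))

∑-cartesianProductWith : ∀ {Z : Set} (g : A → B → Z) (xs : List A) (ys : List B) (h : Z → ℕ) →
  ∑ (cartesianProductWith g xs ys) h ≡ ∑[ x ∈ xs ] ∑[ y ∈ ys ] h (g x y)
∑-cartesianProductWith g []       ys h = refl
∑-cartesianProductWith g (x ∷ xs) ys h = begin
  ∑ (map (g x) ys ++ cartesianProductWith g xs ys) h   ≡⟨ ∑-++ (map (g x) ys) _ h ⟩
  ∑ (map (g x) ys) h + ∑ (cartesianProductWith g xs ys) h
    ≡⟨ cong₂ _+_ (cong sum (sym (map-∘ ys))) (∑-cartesianProductWith g xs ys h) ⟩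
  ∑[ y ∈ ys ] h (g x y) + ∑[ x ∈ xs ] ∑[ y ∈ ys ] h (g x y) ∎
  where open ≡-Reasoning

length-cartesianProductWith : ∀ {Z : Set} (g : A → B → Z) (xs : List A) (ys : List B) →
  length (cartesianProductWith g xs ys) ≡ length xs * length ys
length-cartesianProductWith g []       ys = refl
length-cartesianProductWith g (x ∷ xs) ys = trans (length-++ (map (g x) ys))
  (cong₂ _+_ (length-map (g x) ys) (length-cartesianProductWith g xs ys))

∑-allFin-suc : ∀ {r} (f : Fin (suc r) → ℕ) → ∑ (allFin (suc r)) f ≡ f fz + ∑[ i ∈ allFin r ] f (fs i)
∑-allFin-suc f = cong (λ xs → f fz + sum xs) (trans (map-tabulate fs f) (sym (map-tabulate id (f ∘ fs))))

count : {P : A → Set} → Decidable P → List A → ℕ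
count P? xs = ∑[ x ∈ xs ] (if does (P? x) then 1 else 0)

module _ {P : A → Set} (P? : Decidable P) where

  count≡length-filter : ∀ xs → count P? xs ≡ length (filter P? xs)
  count≡length-filter [] = refl
  count≡length-filter (x ∷ xs) with does (P? x)
  ... | true  = cong suc (count≡length-filter xs)
  ... | false = count≡length-filter xs

  count-none : ∀ xs → (∀ x → ¬ P x) → count P? xs ≡ 0
  count-none [] ¬P = refl
  count-none (x ∷ xs) ¬P with P? x
  ... | yes p = contradiction p (¬P x)
  ... | no _  = count-none xs ¬P

  count<length⇒∃¬ : ∀ xs → count P? xs < length xs → ∃ λ x → x ∈ xs × ¬ P x
  count<length⇒∃¬ (x ∷ xs) c<l with P? x
  ... | no ¬p = x , here refl , ¬p
  ... | yes _ with count<length⇒∃¬ xs (≤-pred c<l)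
  ...   | y , y∈xs , ¬p = y , there y∈xs , ¬p

  Any⇒1≤count : ∀ {xs} → Any P xs → 1 ≤ count P? xs
  Any⇒1≤count {x ∷ xs} (here p) with P? x
  ... | yes _ = s≤s z≤n
  ... | no ¬p = contradiction p ¬p
  Any⇒1≤count {x ∷ xs} (there p) = ≤-trans (Any⇒1≤count p) (m≤n+m _ _)

  count-proj₁ : ∀ (xs : List A) (ys : List B) →
    count (P? ∘ proj₁) (cartesianProduct xs ys) ≡ count P? xs * length ys
  count-proj₁ xs ys = begin
    count (P? ∘ proj₁) (cartesianProduct xs ys)                   ≡⟨ ∑-cartesianProductWith _,_ xs ys _ ⟩
    ∑[ x ∈ xs ] ∑[ _ ∈ ys ] (if does (P? x) then 1 else 0)         ≡⟨ ∑-cong xs (λ x → trans (∑-const ys _) (*-comm (length ys) _)) ⟩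
    ∑[ x ∈ xs ] ((if does (P? x) then 1 else 0) * length ys)       ≡⟨ ∑-*ʳ xs _ (length ys) ⟩
    count P? xs * length ys                                       ∎
    where open ≡-Reasoning

count-mono-≤ : ∀ {P Q : A → Set} (P? : Decidable P) (Q? : Decidable Q) (xs : List A) →
  (∀ {x} → P x → Q x) → count P? xs ≤ count Q? xs
count-mono-≤ P? Q? xs P⇒Q = ∑-mono-≤ xs pointwise
  where
  pointwise : ∀ x → (if does (P? x) then 1 else 0) ≤ (if does (Q? x) then 1 else 0)
  pointwise x with P? x | Q? x
  ... | yes p | no ¬q = contradiction (P⇒Q p) ¬q
  ... | yes _ | yes _ = s≤s z≤n
  ... | no _  | _     = z≤n

count-Any≤∑count : ∀ {R : A → B → Set} (R? : ∀ x → Decidable (R x)) (xs : List A) (ys : List B) →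
  count (λ x → Any.any? (R? x) ys) xs ≤ ∑[ x ∈ xs ] count (R? x) ys
count-Any≤∑count R? xs ys = ∑-mono-≤ xs pointwise
  where
  pointwise : ∀ x → (if does (Any.any? (R? x) ys) then 1 else 0) ≤ count (R? x) ys
  pointwise x with Any.any? (R? x) ys
  ... | yes any = Any⇒1≤count (R? x) any
  ... | no _    = z≤n

unique⊆⇒length≤ : ∀ {xs ys : List A} → Unique xs → (∀ {x} → x ∈ xs → x ∈ ys) → length xs ≤ length ys
unique⊆⇒length≤ {xs = []} _ _ = z≤n
unique⊆⇒length≤ {xs = x ∷ xs} (x∉xs ∷ unique) xs⊆ys with ∈-∃++ (xs⊆ys (here refl))
... | ys₁ , ys₂ , refl = begin
  suc (length xs)                ≤⟨ s≤s (unique⊆⇒length≤ unique xs⊆ys₁++ys₂) ⟩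
  suc (length (ys₁ ++ ys₂))      ≡⟨ cong suc (length-++ ys₁) ⟩
  suc (length ys₁ + length ys₂)  ≡⟨ +-suc (length ys₁) (length ys₂) ⟨
  length ys₁ + length (x ∷ ys₂)  ≡⟨ length-++ ys₁ ⟨
  length (ys₁ ++ x ∷ ys₂)        ∎
  where
  open ≤-Reasoning
  xs⊆ys₁++ys₂ : ∀ {y} → y ∈ xs → y ∈ ys₁ ++ ys₂
  xs⊆ys₁++ys₂ {y} y∈xs with ∈-++⁻ ys₁ (xs⊆ys (there y∈xs))
  ... | inj₁ y∈ys₁         = ∈-++⁺ˡ y∈ys₁
  ... | inj₂ (here refl)   = contradiction refl (All.lookup x∉xs y∈xs)
  ... | inj₂ (there y∈ys₂) = ∈-++⁺ʳ ys₁ y∈ys₂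

count-≤-injection : ∀ {P : A → Set} {Q : B → Set} (P? : Decidable P) (Q? : Decidable Q)
  {xs : List A} {ys : List B} (f : A → B) → (∀ {x y} → f x ≡ f y → x ≡ y) → Unique xs →
  (∀ {x} → x ∈ xs → P x → f x ∈ ys × Q (f x)) → count P? xs ≤ count Q? ys
count-≤-injection P? Q? {xs} {ys} f f-injective unique maps-into = begin
  count P? xs                      ≡⟨ count≡length-filter P? xs ⟩
  length (filter P? xs)            ≡⟨ length-map f (filter P? xs) ⟨
  length (map f (filter P? xs))    ≤⟨ unique⊆⇒length≤ (Unique.map⁺ f-injective (Unique.filter⁺ P? unique)) image⊆ ⟩
  length (filter Q? ys)            ≡⟨ count≡length-filter Q? ys ⟨
  count Q? ys                      ∎
  where
  open ≤-Reasoning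
  image⊆ : ∀ {y} → y ∈ map f (filter P? xs) → y ∈ filter Q? ys
  image⊆ y∈ with ∈-map⁻ f y∈
  ... | x , x∈ , refl with ∈-filter⁻ P? x∈
  ...   | x∈xs , px = ∈-filter⁺ Q? (proj₁ (maps-into x∈xs px)) (proj₂ (maps-into x∈xs px))

vectors : List A → (n : ℕ) → List (Vec A n)
vectors as zero    = [ [] ]
vectors as (suc n) = cartesianProductWith _∷_ as (vectors as n)

module _ {as : List A} where

  ∈-vectors : (∀ a → a ∈ as) → ∀ {n} (v : Vec A n) → v ∈ vectors as n
  ∈-vectors every []      = here refl
  ∈-vectors every (a ∷ v) = ∈-cartesianProductWith⁺ _∷_ (every a) (∈-vectors every v)

  vectors-unique : Unique as → ∀ n → Unique (vectors as n)
  vectors-unique unique zero    = [] ∷ []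
  vectors-unique unique (suc n) =
    Unique.cartesianProductWith⁺ _∷_ ∷-injective unique (vectors-unique unique n)

  length-vectors : ∀ n → length (vectors as n) ≡ length as ^ n
  length-vectors zero    = refl
  length-vectors (suc n) = trans (length-cartesianProductWith _∷_ as (vectors as n)) (cong (length as *_) (length-vectors n))

  ∑-vectors-+ : ∀ m n (f : Vec A (m + n) → ℕ) →
    ∑ (vectors as (m + n)) f ≡ ∑[ x ∈ vectors as m ] ∑[ y ∈ vectors as n ] f (x Vec.++ y)
  ∑-vectors-+ zero    n f = sym (+-identityʳ _)
  ∑-vectors-+ (suc m) n f = begin
    ∑ (vectors as (suc m + n)) f                                          ≡⟨ ∑-cartesianProductWith _∷_ as _ f ⟩
    ∑[ a ∈ as ] ∑[ v ∈ vectors as (m + n) ] f (a ∷ v)                      ≡⟨ ∑-cong as (λ a → ∑-vectors-+ m n (f ∘ (a ∷_))) ⟩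
    ∑[ a ∈ as ] ∑[ x ∈ vectors as m ] ∑[ y ∈ vectors as n ] f (a ∷ x Vec.++ y) ≡⟨ ∑-cartesianProductWith _∷_ as _ _ ⟨
    ∑[ x ∈ vectors as (suc m) ] ∑[ y ∈ vectors as n ] f (x Vec.++ y)        ∎
    where open ≡-Reasoning

  count-vectors-suc : ∀ {n} {P : Vec A (suc n) → Set} (P? : Decidable P) →
    count P? (vectors as (suc n)) ≡ ∑[ a ∈ as ] count (λ v → P? (a ∷ v)) (vectors as n)
  count-vectors-suc {n} P? = ∑-cartesianProductWith _∷_ as (vectors as n) (λ v → if does (P? v) then 1 else 0)

tabulate-injective : ∀ {n} {f g : Fin n → A} → tabulate f ≡ tabulate g → ∀ i → f i ≡ g i
tabulate-injective {f = f} {g} f≡g i =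
  trans (sym (lookup∘tabulate f i)) (trans (cong (λ v → lookup v i) f≡g) (lookup∘tabulate g i))

weight : ∀ {k n} → Fin k → Vec (Fin k) n → ℕ
weight z = Vec.count (λ a → ¬? (a ≟ z))

module _ {k : ℕ} (z : Fin k) where

  weight-++ : ∀ {m n} (x : Vec (Fin k) m) (y : Vec (Fin k) n) → weight z (x Vec.++ y) ≡ weight z x + weight z y
  weight-++ []      y = refl
  weight-++ (a ∷ x) y with does (¬? (a ≟ z))
  ... | true  = cong suc (weight-++ x y)
  ... | false = weight-++ x y

  weight-map : ∀ {n} (f : Fin k → Fin k) → f z ≡ z → (∀ a → f a ≡ z → a ≡ z) →
    (v : Vec (Fin k) n) → weight z (Vec.map f v) ≡ weight z v
  weight-map f f[z]≡z reflects [] = refl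
  weight-map f f[z]≡z reflects (a ∷ v) with f a ≟ z | a ≟ z
  ... | yes _  | yes _ = weight-map f f[z]≡z reflects v
  ... | no _   | no _  = cong suc (weight-map f f[z]≡z reflects v)
  ... | yes fa≡z | no a≢z = contradiction (reflects a fa≡z) a≢z
  ... | no fa≢z  | yes refl = contradiction f[z]≡z fa≢z

length-filter-tabulate : ∀ {P : B → Set} (P? : Decidable P) (f : A → B) {n} (g : Fin n → A) →
  length (filter (P? ∘ f) (List.tabulate g)) ≡ Vec.count P? (tabulate (f ∘ g))
length-filter-tabulate P? f {zero}  g = refl
length-filter-tabulate P? f {suc n} g with does (P? (f (g fz)))
... | true  = cong suc (length-filter-tabulate P? f (g ∘ fs))
... | false = length-filter-tabulate P? f (g ∘ fs)

wt≡weight : ∀ q {k} (v : Fin k → F q) → wt q k v ≡ weight (𝟘 q) (tabulate v)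
wt≡weight q v = length-filter-tabulate (λ a → ¬? (a ≟ 𝟘 q)) v id

data Normalised (z o : A) : ∀ {n} → Vec A n → Set where
  leading-one  : ∀ {n} {v : Vec A n} → Normalised z o (o ∷ v)
  leading-zero : ∀ {n} {v : Vec A n} → Normalised z o v → Normalised z o (z ∷ v)

normalised? : ∀ {k n} (z o : Fin k) → Decidable (Normalised z o {n})
normalised? z o []      = no λ ()
normalised? z o (a ∷ v) with a ≟ o
... | yes refl = yes leading-one
... | no a≢o with a ≟ z
...   | no a≢z   = no λ { leading-one → a≢o refl ; (leading-zero _) → a≢z refl }
...   | yes refl = map′ leading-zero
                     (λ { leading-one → contradiction refl a≢o ; (leading-zero p) → p })
                     (normalised? z o v)

normalised-++ : ∀ {z o : A} {m n} {x : Vec A m} (y : Vec A n) → Normalised z o x → Normalised z o (x Vec.++ y)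
normalised-++ y leading-one      = leading-one
normalised-++ y (leading-zero p) = leading-zero (normalised-++ y p)

normalised⇒leading : ∀ {z o : A} {n} {v : Vec A n} → z ≢ o → Normalised z o v →
  ∃ λ k → lookup v k ≢ z × (∀ i → i Fin.< k → lookup v i ≡ z)
normalised⇒leading z≢o leading-one = fz , z≢o ∘ sym , λ i ()
normalised⇒leading z≢o (leading-zero p) with normalised⇒leading z≢o p
... | k , v[k]≢z , v[<k]≡z = fs k , v[k]≢z , λ { fz _ → refl ; (fs i) (s≤s i<k) → v[<k]≡z i i<k }

Light : ∀ {k n} (z o : Fin k) → ℕ → Vec (Fin k) n → Set
Light z o D v = Normalised z o v × weight z v < D

light? : ∀ {k n} (z o : Fin k) D → Decidable (Light {k} {n} z o D)
light? z o D v = normalised? z o v ×-dec weight z v <? D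

-- Counting words of small weight

ball : ℕ → ℕ → ℕ → ℕ
ball r n zero    = 0
ball r n (suc D) = ball r n D + (n C D) * r ^ D

ball-0 : ∀ r D → ball r 0 (suc D) ≡ 1
ball-0 r zero    = refl
ball-0 r (suc D) = trans (+-identityʳ _) (ball-0 r D)

ball-suc : ∀ r n D → ball r (suc n) (suc D) ≡ ball r n (suc D) + r * ball r n D
ball-suc r n zero    = cong (ball r n 1 +_) (sym (*-zeroʳ r))
ball-suc r n (suc D) = begin
  ball r (suc n) (suc D) + (suc n C suc D) * r ^ suc D
    ≡⟨ cong₂ (λ b c → b + c * r ^ suc D) (ball-suc r n D) (sym (nCk+nC[k+1]≡[n+1]C[k+1] n D)) ⟩
  ball r n (suc D) + r * ball r n D + (n C D + n C suc D) * r ^ suc D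
    ≡⟨ regroup (ball r n (suc D)) (ball r n D) (n C D) (n C suc D) r (r ^ D) ⟩
  ball r n (suc D) + (n C suc D) * r ^ suc D + r * (ball r n D + (n C D) * r ^ D) ∎
  where
  open ≡-Reasoning
  regroup : ∀ b b' c c' r p → b + r * b' + (c + c') * (r * p) ≡ b + c' * (r * p) + r * (b' + c * p)
  regroup = solve-∀

module _ (r : ℕ) where

  count-weight< : ∀ n D → count (λ v → weight fz v <? D) (vectors (allFin (suc r)) n) ≡ ball r n D
  count-weight< zero    zero    = refl
  count-weight< zero    (suc D) = sym (ball-0 r D)
  count-weight< (suc n) zero    = count-none (λ v → weight fz v <? 0) (vectors (allFin (suc r)) (suc n)) λ _ ()
  count-weight< (suc n) (suc D) = begin
    count (λ v → weight fz v <? suc D) (vectors (allFin (suc r)) (suc n))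
      ≡⟨ count-vectors-suc {as = allFin (suc r)} {n} (λ v → weight fz v <? suc D) ⟩
    ∑[ a ∈ allFin (suc r) ] count (λ v → weight fz (a ∷ v) <? suc D) V
      ≡⟨ ∑-allFin-suc (λ a → count (λ v → weight fz (a ∷ v) <? suc D) V) ⟩
    count (λ v → weight fz v <? suc D) V + ∑[ _ ∈ allFin r ] count (λ v → weight fz v <? D) V
      ≡⟨ cong₂ _+_ (count-weight< n (suc D)) (trans (∑-const (allFin r) _) (cong₂ _*_ (length-tabulate {n = r} id) (count-weight< n D))) ⟩
    ball r n (suc D) + r * ball r n D
      ≡⟨ ball-suc r n D ⟨
    ball r (suc n) (suc D) ∎
    where
    open ≡-Reasoning
    V = vectors (allFin (suc r)) n

module _ (r : ℕ) where

  count-normalised : ∀ n D → suc r * count (light? fz (fs fz) (suc D)) (vectors (allFin (suc (suc r))) n) + 1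
                           ≡ ball (suc r) n (suc D)
  count-normalised zero    D = trans (cong (_+ 1) (*-zeroʳ (suc r))) (sym (ball-0 (suc r) D))
  count-normalised (suc n) D = begin
    suc r * count (light? fz (fs fz) (suc D)) (vectors (allFin (suc (suc r))) (suc n)) + 1
      ≡⟨ cong (λ c → suc r * c + 1) (count-vectors-suc {as = allFin (suc (suc r))} {n} (light? fz (fs fz) (suc D))) ⟩
    suc r * ∑[ a ∈ allFin (suc (suc r)) ] count (λ v → light? fz (fs fz) (suc D) (a ∷ v)) V + 1
      ≡⟨ cong (λ c → suc r * c + 1) split ⟩
    suc r * (N + (L + 0)) + 1
      ≡⟨ regroup (suc r) N L ⟩
    (suc r * N + 1) + suc r * L
      ≡⟨ cong₂ _+_ (count-normalised n D) (cong (suc r *_) (count-weight< (suc r) n D)) ⟩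
    ball (suc r) n (suc D) + suc r * ball (suc r) n D
      ≡⟨ ball-suc (suc r) n D ⟨
    ball (suc r) (suc n) (suc D) ∎
    where
    open ≡-Reasoning
    V = vectors (allFin (suc (suc r))) n
    N = count (light? fz (fs fz) (suc D)) V
    L = count (λ v → weight fz v <? D) V
    split : ∑[ a ∈ allFin (suc (suc r)) ] count (λ v → light? fz (fs fz) (suc D) (a ∷ v)) V ≡ N + (L + 0)
    split = begin
      ∑[ a ∈ allFin (suc (suc r)) ] count (λ v → light? fz (fs fz) (suc D) (a ∷ v)) V
        ≡⟨ ∑-allFin-suc (λ a → count (λ v → light? fz (fs fz) (suc D) (a ∷ v)) V) ⟩
      N + ∑[ a ∈ allFin (suc r) ] count (λ v → light? fz (fs fz) (suc D) (fs a ∷ v)) V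
        ≡⟨ cong (N +_) (∑-allFin-suc (λ a → count (λ v → light? fz (fs fz) (suc D) (fs a ∷ v)) V)) ⟩
      N + (L + ∑[ i ∈ allFin r ] count (λ v → light? fz (fs fz) (suc D) (fs (fs i) ∷ v)) V)
        ≡⟨ cong (λ c → N + (L + c)) (∑-cong (allFin r) λ i → count-none (λ v → light? fz (fs fz) (suc D) (fs (fs i) ∷ v)) V λ _ ()) ⟩
      N + (L + ∑[ _ ∈ allFin r ] 0)
        ≡⟨ cong (λ c → N + (L + c)) (trans (∑-const (allFin r) 0) (*-zeroʳ (length (allFin r)))) ⟩
      N + (L + 0) ∎
    regroup : ∀ s N L → s * (N + (L + 0)) + 1 ≡ (s * N + 1) + s * L
    regroup = solve-∀

-- Growth of binomial coefficients and of Hamming balls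

[k+1]*[n+1]C[k+1]≡[n+1]*nCk : ∀ n k → suc k * (suc n C suc k) ≡ suc n * (n C k)
[k+1]*[n+1]C[k+1]≡[n+1]*nCk zero    zero    = refl
[k+1]*[n+1]C[k+1]≡[n+1]*nCk zero    (suc k) = *-zeroʳ (suc (suc k))
[k+1]*[n+1]C[k+1]≡[n+1]*nCk (suc n) zero    = trans (+-identityʳ _) (trans (nC1≡n (suc (suc n))) (sym (*-identityʳ _)))
[k+1]*[n+1]C[k+1]≡[n+1]*nCk (suc n) (suc k) = begin
  suc (suc k) * (suc (suc n) C suc (suc k))
    ≡⟨ cong (suc (suc k) *_) (nCk+nC[k+1]≡[n+1]C[k+1] (suc n) (suc k)) ⟨
  suc (suc k) * ((suc n C suc k) + (suc n C suc (suc k)))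
    ≡⟨ regroup k (suc n C suc k) (suc n C suc (suc k)) ⟩
  (suc n C suc k) + (suc k * (suc n C suc k) + suc (suc k) * (suc n C suc (suc k)))
    ≡⟨ cong ((suc n C suc k) +_) (cong₂ _+_ ([k+1]*[n+1]C[k+1]≡[n+1]*nCk n k) ([k+1]*[n+1]C[k+1]≡[n+1]*nCk n (suc k))) ⟩
  (suc n C suc k) + (suc n * (n C k) + suc n * (n C suc k))
    ≡⟨ cong ((suc n C suc k) +_) (*-distribˡ-+ (suc n) (n C k) (n C suc k)) ⟨
  (suc n C suc k) + suc n * ((n C k) + (n C suc k))
    ≡⟨ cong (λ c → (suc n C suc k) + suc n * c) (nCk+nC[k+1]≡[n+1]C[k+1] n k) ⟩
  suc (suc n) * (suc n C suc k) ∎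
  where
  open ≡-Reasoning
  regroup : ∀ k a b → suc (suc k) * (a + b) ≡ a + (suc k * a + suc (suc k) * b)
  regroup = solve-∀

[n+1∸k]*[n+1]Ck≡[n+1]*nCk : ∀ n k s → suc n ≡ k + s → s * (suc n C k) ≡ suc n * (n C k)
[n+1∸k]*[n+1]Ck≡[n+1]*nCk n zero    s refl = refl
[n+1∸k]*[n+1]Ck≡[n+1]*nCk n (suc k) s eq   = +-cancelˡ-≡ (suc k * X) (s * X) (suc n * (n C suc k)) (begin
  suc k * X + s * X                     ≡⟨ *-distribʳ-+ X (suc k) s ⟨
  (suc k + s) * X                       ≡⟨ cong (_* X) eq ⟨
  suc n * X                             ≡⟨ cong (suc n *_) (nCk+nC[k+1]≡[n+1]C[k+1] n k) ⟨
  suc n * ((n C k) + (n C suc k))       ≡⟨ *-distribˡ-+ (suc n) (n C k) (n C suc k) ⟩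
  suc n * (n C k) + suc n * (n C suc k) ≡⟨ cong (_+ suc n * (n C suc k)) ([k+1]*[n+1]C[k+1]≡[n+1]*nCk n k) ⟨
  suc k * X + suc n * (n C suc k)       ∎)
  where
  open ≡-Reasoning
  X = suc n C suc k

-- (n+2)(n+1) / ((n−w+1)(n−w+2)) is the ratio C(n+2, w) / C(n, w).
RatioBound : ℕ → ℕ → ℕ → Set
RatioBound Q n w = suc (suc n) * suc n ≤ Q * (suc (n ∸ w) * suc (suc (n ∸ w)))

ratioBound⇒[n+2]Cw≤Q*nCw : ∀ Q n w → w ≤ n → RatioBound Q n w → suc (suc n) C w ≤ Q * (n C w)
ratioBound⇒[n+2]Cw≤Q*nCw Q n w w≤n bound = *-cancelˡ-≤ (suc s * suc (suc s)) (begin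
  suc s * suc (suc s) * (suc (suc n) C w)     ≡⟨ *-assoc (suc s) (suc (suc s)) (suc (suc n) C w) ⟩
  suc s * (suc (suc s) * (suc (suc n) C w))   ≡⟨ cong (suc s *_) ([n+1∸k]*[n+1]Ck≡[n+1]*nCk (suc n) w (suc (suc s)) n+2≡w+s+2) ⟩
  suc s * (suc (suc n) * (suc n C w))         ≡⟨ x∙yz≈y∙xz (suc s) (suc (suc n)) (suc n C w) ⟩
  suc (suc n) * (suc s * (suc n C w))         ≡⟨ cong (suc (suc n) *_) ([n+1∸k]*[n+1]Ck≡[n+1]*nCk n w (suc s) n+1≡w+s+1) ⟩
  suc (suc n) * (suc n * (n C w))             ≡⟨ *-assoc (suc (suc n)) (suc n) (n C w) ⟨
  suc (suc n) * suc n * (n C w)               ≤⟨ *-monoˡ-≤ (n C w) bound ⟩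
  Q * (suc s * suc (suc s)) * (n C w)         ≡⟨ trans (*-assoc Q (suc s * suc (suc s)) (n C w)) (x∙yz≈y∙xz Q (suc s * suc (suc s)) (n C w)) ⟩
  suc s * suc (suc s) * (Q * (n C w))         ∎)
  where
  open ≤-Reasoning
  s = n ∸ w
  n+1≡w+s+1 : suc n ≡ w + suc s
  n+1≡w+s+1 = trans (cong suc (sym (m+[n∸m]≡n w≤n))) (sym (+-suc w s))
  n+2≡w+s+2 : suc (suc n) ≡ w + suc (suc s)
  n+2≡w+s+2 = trans (cong suc n+1≡w+s+1) (sym (+-suc w (suc s)))

ratioBound-suc : ∀ Q n w → w ≤ n → RatioBound Q n w → RatioBound Q (suc n) w
ratioBound-suc Q n w w≤n bound rewrite +-∸-assoc 1 w≤n = begin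
  suc (suc (suc n)) * suc (suc n)               ≡⟨ expandˡ n ⟩
  suc (suc n) * suc n + 2 * suc (suc n)         ≤⟨ +-mono-≤ bound (*-monoʳ-≤ 2 n+2≤Q[s+2]) ⟩
  Q * (suc s * suc (suc s)) + 2 * (Q * suc (suc s)) ≡⟨ expandʳ Q s ⟩
  Q * (suc (suc s) * suc (suc (suc s)))         ∎
  where
  open ≤-Reasoning
  s = n ∸ w
  expandˡ : ∀ n → suc (suc (suc n)) * suc (suc n) ≡ suc (suc n) * suc n + 2 * suc (suc n)
  expandˡ = solve-∀
  expandʳ : ∀ Q s → Q * (suc s * suc (suc s)) + 2 * (Q * suc (suc s)) ≡ Q * (suc (suc s) * suc (suc (suc s)))
  expandʳ = solve-∀
  n+2≤Q[s+2] : suc (suc n) ≤ Q * suc (suc s)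
  n+2≤Q[s+2] = *-cancelˡ-≤ (suc n) (begin
    suc n * suc (suc n)           ≡⟨ *-comm (suc n) (suc (suc n)) ⟩
    suc (suc n) * suc n           ≤⟨ bound ⟩
    Q * (suc s * suc (suc s))     ≤⟨ *-monoʳ-≤ Q (*-monoˡ-≤ (suc (suc s)) (s≤s (m∸n≤m n w))) ⟩
    Q * (suc n * suc (suc s))     ≡⟨ x∙yz≈y∙xz Q (suc n) (suc (suc s)) ⟩
    suc n * (Q * suc (suc s))     ∎)

ratioBound-+ : ∀ Q n w t → w ≤ n → RatioBound Q n w → RatioBound Q (n + t) w
ratioBound-+ Q n w zero    w≤n bound = subst (λ n → RatioBound Q n w) (sym (+-identityʳ n)) bound
ratioBound-+ Q n w (suc t) w≤n bound = subst (λ n → RatioBound Q n w) (sym (+-suc n t))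
  (ratioBound-suc Q (n + t) w (≤-trans w≤n (m≤m+n n t)) (ratioBound-+ Q n w t w≤n bound))

ratioBound-mono : ∀ {Q n n′ w w′} → w ≤ n → n ≤ n′ → w′ ≤ w → RatioBound Q n w → RatioBound Q n′ w′
ratioBound-mono {Q} {n} {n′} {w} {w′} w≤n n≤n′ w′≤w bound =
  ≤-trans (subst (λ n′ → RatioBound Q n′ w) (m+[n∸m]≡n n≤n′) (ratioBound-+ Q n w (n′ ∸ n) w≤n bound))
          (*-monoʳ-≤ Q (*-mono-≤ (s≤s s≤s′) (s≤s (s≤s s≤s′))))
  where s≤s′ = ∸-monoʳ-≤ n′ w′≤w

ball-growth : ∀ r Q n D → (∀ w → w < D → suc (suc n) C w ≤ Q * (n C w)) →
  ball r (suc (suc n)) D ≤ Q * ball r n D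
ball-growth r Q n zero    growth = z≤n
ball-growth r Q n (suc D) growth = begin
  ball r (suc (suc n)) D + (suc (suc n) C D) * r ^ D
    ≤⟨ +-mono-≤ (ball-growth r Q n D λ w w<D → growth w (m<n⇒m<1+n w<D)) (*-monoˡ-≤ (r ^ D) (growth D ≤-refl)) ⟩
  Q * ball r n D + Q * (n C D) * r ^ D
    ≡⟨ cong (Q * ball r n D +_) (*-assoc Q (n C D) (r ^ D)) ⟩
  Q * ball r n D + Q * ((n C D) * r ^ D)
    ≡⟨ *-distribˡ-+ Q (ball r n D) _ ⟨
  Q * ball r n (suc D) ∎
  where open ≤-Reasoning

ball-tail : ∀ r Q m₀ D → D ≤ m₀ + m₀ → RatioBound Q (m₀ + m₀) D → ball r (m₀ + m₀) (suc D) ≤ r * Q ^ m₀ →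
  ∀ m → m₀ ≤ m → ball r (m + m) (suc D) ≤ r * Q ^ m
ball-tail r Q m₀ D D≤2m₀ bound base m m₀≤m =
  subst (λ m → ball r (m + m) (suc D) ≤ r * Q ^ m) (m+[n∸m]≡n m₀≤m) (from-m₀ (m ∸ m₀))
  where
  open ≤-Reasoning
  from-m₀ : ∀ t → ball r ((m₀ + t) + (m₀ + t)) (suc D) ≤ r * Q ^ (m₀ + t)
  from-m₀ zero    = subst (λ m → ball r (m + m) (suc D) ≤ r * Q ^ m) (sym (+-identityʳ m₀)) base
  from-m₀ (suc t) = begin
    ball r ((m₀ + suc t) + (m₀ + suc t)) (suc D)  ≡⟨ cong (λ n → ball r n (suc D)) (twice-suc m₀ t) ⟩
    ball r (suc (suc n)) (suc D)                  ≤⟨ ball-growth r Q n (suc D) growth ⟩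
    Q * ball r n (suc D)                          ≤⟨ *-monoʳ-≤ Q (from-m₀ t) ⟩
    Q * (r * Q ^ (m₀ + t))                        ≡⟨ x∙yz≈y∙xz Q r (Q ^ (m₀ + t)) ⟩
    r * Q ^ suc (m₀ + t)                          ≡⟨ cong (λ e → r * Q ^ e) (+-suc m₀ t) ⟨
    r * Q ^ (m₀ + suc t)                          ∎
    where
    n = (m₀ + t) + (m₀ + t)
    twice-suc : ∀ m t → (m + suc t) + (m + suc t) ≡ suc (suc ((m + t) + (m + t)))
    twice-suc = solve-∀
    2m₀≤n : m₀ + m₀ ≤ n
    2m₀≤n = +-mono-≤ (m≤m+n m₀ t) (m≤m+n m₀ t)
    growth : ∀ w → w < suc D → suc (suc n) C w ≤ Q * (n C w)
    growth w (s≤s w≤D) = ratioBound⇒[n+2]Cw≤Q*nCw Q n w (≤-trans w≤D (≤-trans D≤2m₀ 2m₀≤n))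
      (ratioBound-mono {Q} D≤2m₀ 2m₀≤n w≤D bound)

-- Toeplitz matrices by their diagonals

diag : ∀ {q n} → Vec (F q) n → ℕ → F q
diag {q} []      e       = 𝟘 q
diag     (a ∷ c) zero    = a
diag     (a ∷ c) (suc e) = diag c e

module _ {q : FieldSize} where

  diag-beyond : ∀ {n} (c : Vec (F q) n) {e} → n ≤ e → diag c e ≡ 𝟘 q
  diag-beyond []      _         = refl
  diag-beyond (a ∷ c) (s≤s n≤e) = diag-beyond c n≤e

  diag-ext : ∀ {n} (c c′ : Vec (F q) n) → (∀ e → diag c e ≡ diag c′ e) → c ≡ c′
  diag-ext []      []        _    = refl
  diag-ext (a ∷ c) (a′ ∷ c′) same = cong₂ _∷_ (same 0) (diag-ext c c′ (same ∘ suc))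

  at-shift : ∀ {k} (g : ℕ → F q) s → 1 ≤ s → s ≤ k → at {q} {k} (λ i → g (suc (toℕ i))) s ≡ g s
  at-shift {suc k} g (suc zero)    _ _         = refl
  at-shift {suc k} g (suc (suc s)) _ (s≤s s≤k) = at-shift (g ∘ suc) (suc s) (s≤s z≤n) s≤k

Diagonals : FieldSize → ℕ → Set
Diagonals q m′ = Vec (F q) (suc (m′ + m′))

toeplitzᵈ : ∀ {q} m′ → Diagonals q m′ → Fin (suc m′) → Fin (suc m′) → F q
toeplitzᵈ {q} m′ c = toeplitz q (suc m′) (diag c m′) (λ s → diag c (m′ + suc (toℕ s))) (λ s → diag c (m′ ∸ suc (toℕ s)))

toeplitzᵈ-entry : ∀ {q} m′ (c : Diagonals q m′) i j → toeplitzᵈ m′ c i j ≡ diag c (toℕ j + m′ ∸ toℕ i)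
toeplitzᵈ-entry m′ c i j with toℕ i <ᵇ toℕ j | <ᵇ-reflects-< (toℕ i) (toℕ j)
... | true  | ofʸ i<j = trans
  (at-shift (λ s → diag c (m′ + s)) (toℕ j ∸ toℕ i) (m<n⇒0<n∸m i<j) (≤-trans (m∸n≤m (toℕ j) (toℕ i)) (toℕ≤pred[n] j)))
  (cong (diag c) (trans (sym (+-∸-assoc m′ (<⇒≤ i<j))) (cong (_∸ toℕ i) (+-comm m′ (toℕ j)))))
... | false | ofⁿ i≮j with toℕ j <ᵇ toℕ i | <ᵇ-reflects-< (toℕ j) (toℕ i)
...   | true  | ofʸ j<i = trans
  (at-shift (λ s → diag c (m′ ∸ s)) (toℕ i ∸ toℕ j) (m<n⇒0<n∸m j<i) (≤-trans (m∸n≤m (toℕ i) (toℕ j)) (toℕ≤pred[n] i)))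
  (cong (diag c) (begin
    m′ ∸ (toℕ i ∸ toℕ j)                   ≡⟨ [m+n]∸[m+o]≡n∸o (toℕ j) m′ (toℕ i ∸ toℕ j) ⟨
    toℕ j + m′ ∸ (toℕ j + (toℕ i ∸ toℕ j)) ≡⟨ cong (toℕ j + m′ ∸_) (m+[n∸m]≡n (<⇒≤ j<i)) ⟩
    toℕ j + m′ ∸ toℕ i                     ∎))
  where open ≡-Reasoning
...   | false | ofⁿ j≮i = cong (diag c) (begin
    m′                 ≡⟨ m+n∸m≡n (toℕ j) m′ ⟨
    toℕ j + m′ ∸ toℕ j ≡⟨ cong (toℕ j + m′ ∸_) (≤-antisym (≮⇒≥ i≮j) (≮⇒≥ j≮i)) ⟩
    toℕ j + m′ ∸ toℕ i ∎)
  where open ≡-Reasoning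

checkPart : ∀ {q} m′ → Diagonals q m′ → (Fin (suc m′) → F q) → Vec (F q) (suc m′)
checkPart {q} m′ c x = tabulate (rightHalf q (suc m′) (toeplitzᵈ m′ c) x)

-- Let x_k be the first nonzero entry of x.  Row k of T_c meets diagonal j + o in column j, so
-- entry j of x·T_c is x_k times that diagonal plus terms on lower diagonals: x·T_c together
-- with the diagonals row k misses determines c.
module Pivot {q : FieldSize} {m′ : ℕ} (x : Fin (suc m′) → F q) (k : Fin (suc m′))
             (x[k]≢0 : x k ≢ 𝟘 q) (x[<k]≡0 : ∀ i → i Fin.< k → x i ≡ 𝟘 q) where

  o : ℕ
  o = m′ ∸ toℕ k

  freeDiagonals : Diagonals q m′ → Vec (F q) o × Vec (F q) (toℕ k)
  freeDiagonals c = tabulate (λ s → diag c (toℕ s)) , tabulate (λ s → diag c (suc (o + m′ + toℕ s)))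

  data Position (e : ℕ) : Set where
    lower  : (s : Fin o) → toℕ s ≡ e → Position e
    pivot  : (j : Fin (suc m′)) → toℕ j + o ≡ e → Position e
    upper  : (s : Fin (toℕ k)) → suc (o + m′ + toℕ s) ≡ e → Position e
    beyond : suc (m′ + m′) ≤ e → Position e

  position : ∀ e → Position e
  position e with e <? o
  ... | yes e<o = lower (fromℕ< e<o) (toℕ-fromℕ< e<o)
  ... | no e≮o with e ≤? o + m′
  ...   | yes e≤o+m′ = pivot (fromℕ< e∸o<m′+1) (trans (cong (_+ o) (toℕ-fromℕ< e∸o<m′+1)) (m∸n+n≡m (≮⇒≥ e≮o)))
    where e∸o<m′+1 = s≤s (m≤n+o⇒m∸n≤o e o e≤o+m′)
  ...   | no e≰o+m′ with e <? suc (m′ + m′)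
  ...     | no e≮2m′+1 = beyond (≮⇒≥ e≮2m′+1)
  ...     | yes e<2m′+1 = upper (fromℕ< s<k) (trans (cong (λ s → suc (o + m′ + s)) (toℕ-fromℕ< s<k)) (m+[n∸m]≡n o+m′+1≤e))
    where
    o+m′+1≤e = ≰⇒> e≰o+m′
    2m′+1≡o+m′+1+k : suc (m′ + m′) ≡ suc (o + m′) + toℕ k
    2m′+1≡o+m′+1+k = cong suc (trans (cong (_+ m′) (sym (m∸n+n≡m (toℕ≤pred[n] k)))) (swap o (toℕ k) m′))
      where
      swap : ∀ a b c → a + b + c ≡ a + c + b
      swap = solve-∀
    s<k : e ∸ suc (o + m′) < toℕ k
    s<k = subst (e ∸ suc (o + m′) <_) (m+n∸m≡n (suc (o + m′)) (toℕ k))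
            (∸-monoˡ-< (subst (e <_) 2m′+1≡o+m′+1+k e<2m′+1) o+m′+1≤e)

  module _ {c c′ : Diagonals q m′}
           (same-check : ∀ j → rightHalf q (suc m′) (toeplitzᵈ m′ c) x j ≡ rightHalf q (suc m′) (toeplitzᵈ m′ c′) x j)
           (same-free : freeDiagonals c ≡ freeDiagonals c′) where

    pivot-step : ∀ j → (∀ {e} → e < toℕ j + o → diag c e ≡ diag c′ e) → diag c (toℕ j + o) ≡ diag c′ (toℕ j + o)
    pivot-step j earlier = begin
      diag c (toℕ j + o)        ≡⟨ cong (diag c) j+m′-k≡j+o ⟨
      diag c (toℕ j + m′ ∸ toℕ k) ≡⟨ toeplitzᵈ-entry m′ c k j ⟨
      toeplitzᵈ m′ c k j         ≡⟨ mul-cancelˡ q (x k) _ _ x[k]≢0 (sumFin-cancel q k others (same-check j)) ⟩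
      toeplitzᵈ m′ c′ k j        ≡⟨ toeplitzᵈ-entry m′ c′ k j ⟩
      diag c′ (toℕ j + m′ ∸ toℕ k) ≡⟨ cong (diag c′) j+m′-k≡j+o ⟩
      diag c′ (toℕ j + o)        ∎
      where
      open ≡-Reasoning
      j+m′-k≡j+o : toℕ j + m′ ∸ toℕ k ≡ toℕ j + o
      j+m′-k≡j+o = +-∸-assoc (toℕ j) (toℕ≤pred[n] k)
      others : ∀ i → i ≢ k → mul q (x i) (toeplitzᵈ m′ c i j) ≡ mul q (x i) (toeplitzᵈ m′ c′ i j)
      others i i≢k with <-cmp (toℕ i) (toℕ k)
      ... | tri< i<k _ _ = trans (vanishes _) (sym (vanishes _))
        where
        vanishes : ∀ a → mul q (x i) a ≡ 𝟘 q
        vanishes a = trans (cong (λ b → mul q b a) (x[<k]≡0 i i<k)) (mul-zeroˡ q a)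
      ... | tri≈ _ i≡k _ = contradiction (toℕ-injective i≡k) i≢k
      ... | tri> _ _ k<i = cong (mul q (x i)) (begin
        toeplitzᵈ m′ c i j           ≡⟨ toeplitzᵈ-entry m′ c i j ⟩
        diag c (toℕ j + m′ ∸ toℕ i)  ≡⟨ earlier (subst (toℕ j + m′ ∸ toℕ i <_) j+m′-k≡j+o
                                          (∸-monoʳ-< k<i (≤-trans (toℕ≤pred[n] i) (m≤n+m m′ (toℕ j))))) ⟩
        diag c′ (toℕ j + m′ ∸ toℕ i) ≡⟨ toeplitzᵈ-entry m′ c′ i j ⟨
        toeplitzᵈ m′ c′ i j          ∎)

    same-diagonals : ∀ e → diag c e ≡ diag c′ e
    same-diagonals = <-rec (λ e → diag c e ≡ diag c′ e) step
      where
      step : ∀ e → (∀ {e′} → e′ < e → diag c e′ ≡ diag c′ e′) → diag c e ≡ diag c′ e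
      step e earlier with position e
      ... | lower s refl = tabulate-injective (cong proj₁ same-free) s
      ... | upper s refl = tabulate-injective (cong proj₂ same-free) s
      ... | pivot j refl = pivot-step j earlier
      ... | beyond 2m′+1≤e = trans (diag-beyond c 2m′+1≤e) (sym (diag-beyond c′ 2m′+1≤e))

  encode : Diagonals q m′ → Vec (F q) (suc m′) × Vec (F q) o × Vec (F q) (toℕ k)
  encode c = checkPart m′ c x , freeDiagonals c

  encode-injective : ∀ {c c′} → encode c ≡ encode c′ → c ≡ c′
  encode-injective {c} {c′} same =
    diag-ext c c′ (same-diagonals {c} {c′} (tabulate-injective (cong proj₁ same)) (cong proj₂ same))

module _ (q : FieldSize) where

  wt-cong : ∀ {k} {v w : Fin k → F q} → (∀ i → v i ≡ w i) → wt q k v ≡ wt q k w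
  wt-cong {k} {v} {w} v≗w = begin
    wt q k v                  ≡⟨ wt≡weight q v ⟩
    weight (𝟘 q) (tabulate v) ≡⟨ cong (weight (𝟘 q)) (tabulate-cong v≗w) ⟩
    weight (𝟘 q) (tabulate w) ≡⟨ wt≡weight q w ⟨
    wt q k w                  ∎
    where open ≡-Reasoning

  wt-scale : ∀ {k} {μ : F q} → μ ≢ 𝟘 q → (v : Fin k → F q) → wt q k (λ i → mul q μ (v i)) ≡ wt q k v
  wt-scale {k} {μ} μ≢0 v = begin
    wt q k (λ i → mul q μ (v i))               ≡⟨ wt≡weight q (mul q μ ∘ v) ⟩
    weight (𝟘 q) (tabulate (mul q μ ∘ v))      ≡⟨ cong (weight (𝟘 q)) (tabulate-∘ (mul q μ) v) ⟩
    weight (𝟘 q) (Vec.map (mul q μ) (tabulate v)) ≡⟨ weight-map (𝟘 q) (mul q μ) (mul-zeroʳ q μ) reflects (tabulate v) ⟩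
    weight (𝟘 q) (tabulate v)                  ≡⟨ wt≡weight q v ⟨
    wt q k v                                   ∎
    where
    open ≡-Reasoning
    reflects : ∀ a → mul q μ a ≡ 𝟘 q → a ≡ 𝟘 q
    reflects a μa≡0 = mul-cancelˡ q μ a (𝟘 q) μ≢0 (trans μa≡0 (sym (mul-zeroʳ q μ)))

  module _ {m : ℕ} (T : Fin m → Fin m → F q) where

    codewordWeight-cong : ∀ {x y : Fin m → F q} → (∀ i → x i ≡ y i) → codewordWeight q m T x ≡ codewordWeight q m T y
    codewordWeight-cong x≗y = cong₂ _+_ (wt-cong x≗y)
      (wt-cong λ j → sumFin-cong q λ i → cong (λ a → mul q a (T i j)) (x≗y i))

    codewordWeight-scale : ∀ {μ : F q} → μ ≢ 𝟘 q → (x : Fin m → F q) →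
      codewordWeight q m T (λ i → mul q μ (x i)) ≡ codewordWeight q m T x
    codewordWeight-scale {μ} μ≢0 x = cong₂ _+_ (wt-scale μ≢0 x) (begin
      wt q m (rightHalf q m T (λ i → mul q μ (x i)))  ≡⟨ wt-cong (λ j → sumFin-cong q λ i → mul-assoc q μ (x i) (T i j)) ⟩
      wt q m (λ j → sumFin q (λ i → mul q μ (mul q (x i) (T i j)))) ≡⟨ wt-cong (λ j → sumFin-scale q μ (λ i → mul q (x i) (T i j))) ⟩
      wt q m (λ j → mul q μ (rightHalf q m T x j))    ≡⟨ wt-scale μ≢0 (rightHalf q m T x) ⟩
      wt q m (rightHalf q m T x)                      ∎)
      where open ≡-Reasoning

    codewordWeight-lookup : (x : Vec (F q) m) →
      codewordWeight q m T (lookup x) ≡ weight (𝟘 q) x + weight (𝟘 q) (tabulate (rightHalf q m T (lookup x)))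
    codewordWeight-lookup x = cong₂ _+_
      (trans (wt≡weight q (lookup x)) (cong (weight (𝟘 q)) (tabulate∘lookup x)))
      (wt≡weight q (rightHalf q m T (lookup x)))

  normalise : ∀ {n} (v : Vec (F q) n) → (∃ λ i → lookup v i ≢ 𝟘 q) →
    ∃ λ μ → μ ≢ 𝟘 q × Normalised (𝟘 q) (one q) (Vec.map (mul q μ) v)
  normalise (a ∷ v) (i , v[i]≢0) with a ≟ 𝟘 q
  ... | no a≢0 with mul-inverseˡ q a a≢0
  ...   | μ , μ≢0 , μa≡1 = μ , μ≢0 , subst (λ b → Normalised (𝟘 q) (one q) (b ∷ Vec.map (mul q μ) v)) (sym μa≡1) leading-one
  normalise (a ∷ v) (fz , a≢0)     | yes a≡0 = contradiction a≡0 a≢0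
  normalise (a ∷ v) (fs i , v[i]≢0) | yes refl with normalise v (i , v[i]≢0)
  ... | μ , μ≢0 , normal = μ , μ≢0 , subst (λ b → Normalised (𝟘 q) (one q) (b ∷ Vec.map (mul q μ) v)) (sym (mul-zeroʳ q μ)) (leading-zero normal)

-- The counting argument

instance
  order-nonZero : ∀ {q} → NonZero (order q)
  order-nonZero {GF2} = _
  order-nonZero {GF3} = _
  order-nonZero {GF4} = _

words : ∀ q n → List (Vec (F q) n)
words q = vectors (allFin (order q))

∈-words : ∀ q {n} (v : Vec (F q) n) → v ∈ words q n
∈-words q = ∈-vectors ∈-allFin

length-words : ∀ q n → length (words q n) ≡ order q ^ n
length-words q n = trans (length-vectors n) (cong (_^ n) (length-tabulate id))

module Counting (q : FieldSize) (m′ d : ℕ) where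

  private
    m = suc m′
    X = words q m
    P = words q (suc (m′ + m′))

  Bad : Diagonals q m′ → Vec (F q) m → Set
  Bad c x = Normalised (𝟘 q) (one q) x × codewordWeight q m (toeplitzᵈ m′ c) (lookup x) < d

  bad? : ∀ c → Decidable (Bad c)
  bad? c x = normalised? (𝟘 q) (one q) x ×-dec codewordWeight q m (toeplitzᵈ m′ c) (lookup x) <? d

  LightPair : Vec (F q) m → Vec (F q) m → Set
  LightPair x y = Normalised (𝟘 q) (one q) x × weight (𝟘 q) x + weight (𝟘 q) y < d

  lightPair? : ∀ x → Decidable (LightPair x)
  lightPair? x y = normalised? (𝟘 q) (one q) x ×-dec weight (𝟘 q) x + weight (𝟘 q) y <? d

  count-bad≤-normalised : ∀ {x} → Normalised (𝟘 q) (one q) x →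
    count (λ c → bad? c x) P ≤ count (lightPair? x) X * order q ^ m′
  count-bad≤-normalised {x} normal with normalised⇒leading (one≢𝟘 q ∘ sym) normal
  ... | k , x[k]≢0 , x[<k]≡0 = begin
    count (λ c → bad? c x) P
      ≤⟨ count-≤-injection (λ c → bad? c x) (lightPair? x ∘ proj₁) encode encode-injective
           (vectors-unique (Unique.allFin⁺ (order q)) _) maps-into ⟩
    count (lightPair? x ∘ proj₁) (cartesianProduct X (cartesianProduct (words q o) (words q (toℕ k))))
      ≡⟨ count-proj₁ (lightPair? x) X _ ⟩
    count (lightPair? x) X * length (cartesianProduct (words q o) (words q (toℕ k)))
      ≡⟨ cong (count (lightPair? x) X *_) free-count ⟩
    count (lightPair? x) X * order q ^ m′ ∎
    where
    open Pivot (lookup x) k x[k]≢0 x[<k]≡0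
    open ≤-Reasoning
    maps-into : ∀ {c} → c ∈ P → Bad c x →
      encode c ∈ cartesianProduct X (cartesianProduct (words q o) (words q (toℕ k))) × LightPair x (checkPart m′ c (lookup x))
    maps-into {c} _ (_ , light) =
      ∈-cartesianProduct⁺ (∈-words q _) (∈-cartesianProduct⁺ (∈-words q _) (∈-words q _)) ,
      normal , subst (_< d) (codewordWeight-lookup q (toeplitzᵈ m′ c) x) light
    free-count : length (cartesianProduct (words q o) (words q (toℕ k))) ≡ order q ^ m′
    free-count = begin-equality
      length (cartesianProduct (words q o) (words q (toℕ k)))  ≡⟨ length-cartesianProductWith _,_ (words q o) _ ⟩
      length (words q o) * length (words q (toℕ k))           ≡⟨ cong₂ _*_ (length-words q o) (length-words q (toℕ k)) ⟩
      order q ^ o * order q ^ toℕ k                           ≡⟨ ^-distribˡ-+-* (order q) o (toℕ k) ⟨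
      order q ^ (o + toℕ k)                                   ≡⟨ cong (order q ^_) (m∸n+n≡m (toℕ≤pred[n] k)) ⟩
      order q ^ m′                                            ∎

  count-bad≤ : ∀ x → count (λ c → bad? c x) P ≤ count (lightPair? x) X * order q ^ m′
  count-bad≤ x = by-cases (normalised? (𝟘 q) (one q) x)
    where
    by-cases : Dec (Normalised (𝟘 q) (one q) x) → count (λ c → bad? c x) P ≤ count (lightPair? x) X * order q ^ m′
    by-cases (yes normal)  = count-bad≤-normalised normal
    by-cases (no ¬normal) = ≤-trans (≤-reflexive (count-none (λ c → bad? c x) P (λ _ → ¬normal ∘ proj₁))) z≤n

  ∑-lightPair≤ : ∑[ x ∈ X ] count (lightPair? x) X ≤ count (light? (𝟘 q) (one q) d) (words q (m + m))
  ∑-lightPair≤ = begin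
    ∑[ x ∈ X ] count (lightPair? x) X
      ≤⟨ ∑-mono-≤ X (λ x → count-mono-≤ (lightPair? x) (λ y → light? (𝟘 q) (one q) d (x Vec.++ y)) X
           λ { {y} (normal , light) → normalised-++ y normal , subst (_< d) (sym (weight-++ (𝟘 q) x y)) light }) ⟩
    ∑[ x ∈ X ] count (λ y → light? (𝟘 q) (one q) d (x Vec.++ y)) X
      ≡⟨ ∑-vectors-+ {as = allFin (order q)} m m (λ z → if does (light? (𝟘 q) (one q) d z) then 1 else 0) ⟨
    count (light? (𝟘 q) (one q) d) (words q (m + m)) ∎
    where open ≤-Reasoning

  good-diagonals : count (light? (𝟘 q) (one q) d) (words q (m + m)) < order q ^ m → ∃ λ c → ¬ Any (Bad c) X
  good-diagonals few with count<length⇒∃¬ (λ c → Any.any? (bad? c) X) P bound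
    where
    open ≤-Reasoning
    bound : count (λ c → Any.any? (bad? c) X) P < length P
    bound = begin-strict
      count (λ c → Any.any? (bad? c) X) P                  ≤⟨ count-Any≤∑count bad? P X ⟩
      ∑[ c ∈ P ] count (bad? c) X                           ≡⟨ ∑-comm P X (λ c x → if does (bad? c x) then 1 else 0) ⟩
      ∑[ x ∈ X ] count (λ c → bad? c x) P                   ≤⟨ ∑-mono-≤ X count-bad≤ ⟩
      ∑[ x ∈ X ] (count (lightPair? x) X * order q ^ m′)    ≡⟨ ∑-*ʳ X (λ x → count (lightPair? x) X) (order q ^ m′) ⟩
      (∑[ x ∈ X ] count (lightPair? x) X) * order q ^ m′    ≤⟨ *-monoˡ-≤ (order q ^ m′) ∑-lightPair≤ ⟩
      count (light? (𝟘 q) (one q) d) (words q (m + m)) * order q ^ m′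
        <⟨ *-monoˡ-< (order q ^ m′) {{m^n≢0 (order q) m′}} few ⟩
      order q ^ m * order q ^ m′                            ≡⟨ ^-distribˡ-+-* (order q) m m′ ⟨
      order q ^ (m + m′)                                    ≡⟨ length-words q (m + m′) ⟨
      length P                                              ∎
  ... | c , _ , good = c , good

  good⇒minWeight : ∀ {c} → ¬ Any (Bad c) X → MinWeightAtLeast q m (toeplitzᵈ m′ c) d
  good⇒minWeight {c} good x (i , x[i]≢0)
    with normalise q (tabulate x) (i , subst (_≢ 𝟘 q) (sym (lookup∘tabulate x i)) x[i]≢0)
  ... | μ , μ≢0 , normal = ≮⇒≥ λ light → good (lose (∈-words q x′) (normal , subst (_< d) (sym same-weight) light))
    where
    x′ = Vec.map (mul q μ) (tabulate x)
    same-weight : codewordWeight q m (toeplitzᵈ m′ c) (lookup x′) ≡ codewordWeight q m (toeplitzᵈ m′ c) x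
    same-weight = trans
      (codewordWeight-cong q (toeplitzᵈ m′ c) λ i → trans (lookup-map i (mul q μ) (tabulate x)) (cong (mul q μ) (lookup∘tabulate x i)))
      (codewordWeight-scale q (toeplitzᵈ m′ c) μ≢0 x)

doubleToeplitz-exists : ∀ q m′ d → count (light? (𝟘 q) (one q) d) (words q (suc m′ + suc m′)) < order q ^ suc m′ →
  ∃[ t ] ∃[ a ] ∃[ b ] MinWeightAtLeast q (suc m′) (toeplitz q (suc m′) t a b) d
doubleToeplitz-exists q m′ d few with Counting.good-diagonals q m′ d few
... | c , good = diag c m′ , _ , _ , Counting.good⇒minWeight q m′ d {c} good

units : FieldSize → ℕ
units q = order q ∸ 1

count-light : ∀ q n D → units q * count (light? (𝟘 q) (one q) (suc D)) (words q n) + 1 ≡ ball (units q) n (suc D)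
count-light GF2 = count-normalised 0
count-light GF3 = count-normalised 1
count-light GF4 = count-normalised 2

few-light-words : ∀ q m D → ball (units q) (m + m) (suc D) ≤ units q * order q ^ m →
  count (light? (𝟘 q) (one q) (suc D)) (words q (m + m)) < order q ^ m
few-light-words q m D bound = *-cancelˡ-< (units q) _ _ (begin-strict
  units q * count (light? (𝟘 q) (one q) (suc D)) (words q (m + m))      <⟨ m<m+n _ z<s ⟩
  units q * count (light? (𝟘 q) (one q) (suc D)) (words q (m + m)) + 1  ≡⟨ count-light q (m + m) D ⟩
  ball (units q) (m + m) (suc D)                                        ≤⟨ bound ⟩
  units q * order q ^ m                                                 ∎)
  where open ≤-Reasoning

-- The hypotheses of ball-tail at half-length m₀.
Certified : FieldSize → ℕ → ℕ → Set
Certified q m₀ D = D ≤ m₀ + m₀ × RatioBound (order q) (m₀ + m₀) D × ball (units q) (m₀ + m₀) (suc D) ≤ units q * order q ^ m₀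

certified? : ∀ q m₀ D → Dec (Certified q m₀ D)
certified? q m₀ D = D ≤? m₀ + m₀ ×-dec _ ≤? _ ×-dec _ ≤? _

table-certified : ∀ q D → 10 ≤ D → D ≤ 49 → Certified q ⌊ nq q (suc D) /2⌋ D
table-certified q D 10≤D D≤49 = subst (λ D → Certified q ⌊ nq q (suc D) /2⌋ D)
  (trans (cong (10 +_) (toℕ-fromℕ< i<40)) (m+[n∸m]≡n 10≤D)) (every-entry q (fromℕ< i<40))
  where
  every-entry : ∀ q (i : Fin 40) → Certified q ⌊ nq q (11 + toℕ i) /2⌋ (10 + toℕ i)
  every-entry = byEnumeration λ q → all? λ i → certified? q ⌊ nq q (11 + toℕ i) /2⌋ (10 + toℕ i)
  i<40 : D ∸ 10 < 40
  i<40 = s≤s (∸-monoˡ-≤ 10 D≤49)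

⌊n/2⌋≤m : ∀ {n} m → n ≤ 2 * m → ⌊ n /2⌋ ≤ m
⌊n/2⌋≤m {n} m n≤2m =
  subst (⌊ n /2⌋ ≤_) (sym (n≡⌊n+n/2⌋ m)) (⌊n/2⌋-mono (subst (n ≤_) (cong (m +_) (+-identityʳ m)) n≤2m))

proposition4p5 : (q : FieldSize) (d : ℕ) → 11 ≤ d → d ≤ 50
    → (m : ℕ) → nq q d ≤ 2 * m
    → ∃[ t ] ∃[ a ] ∃[ b ] MinWeightAtLeast q m (toeplitz q m t a b) d
proposition4p5 q d _ _ zero _ = 𝟘 q , (λ ()) , (λ ()) , λ { _ (() , _) }
proposition4p5 q (suc D) (s≤s 10≤D) (s≤s D≤49) m@(suc m′) n≤2m =
  doubleToeplitz-exists q m′ (suc D) (few-light-words q m D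
    (ball-tail (units q) (order q) ⌊ nq q (suc D) /2⌋ D D≤2m₀ ratio base m (⌊n/2⌋≤m m n≤2m)))
  where
  certificate = table-certified q D 10≤D D≤49
  D≤2m₀ = proj₁ certificate
  ratio = proj₁ (proj₂ certificate)
  base = proj₂ (proj₂ certificate)
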